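{- Let $K/\mathbb{Q}_p$ be unramified of degree $f$. Let $r_0,\dots,r_{f-1}$ be integers in $[1,p]$, let $J\subset\{0,\dots,f-1\}$, and set $h_i=r_i$ if $i\in J$ and $h_i=0$ if $i\notin J$. Fix $a,b\in k_E^\times$. Let $\overline{\mathfrak{M}}$ be an extension (of $\varphi$-modules over $\mathfrak{S}\otimes_{\mathbb{Z}_p}k_E$) of $\overline{\mathfrak{M}}(h_0,\dots,h_{f-1};a)$ by $\overline{\mathfrak{M}}(r_0-h_0,\dots,r_{f-1}-h_{f-1};b)$. Then one can choose generators $e_i,f_i$ of the $\overline{\mathfrak{M}}_i$ so that \[\varphi(e_{i-1})=(b)_iu^{r_i-h_i}e_i,\qquad\varphi(f_{i-1})=(a)_iu^{h_i}f_i+x_ie_i\] with $x_i\in k_E[[u]]$ a polynomial of degree $<h_i$, except in the following cases: (i) $(r_0,\dots,r_{f-1})\in\mathcal{P}$, $J=\{i: r_{i-1}\ne p\}$, and $a=b$; or (ii) $p=2$, $(r_0,\dots,r_{f-1})=(2,\dots,2)$, $J=\{0,\dots,f-1\}$, and $a=b$. In those cases fix $i_0\in J$; then $x_i$ may be taken to be a polynomial of degree $<h_i$ for all $i\ne i_0$, while $x_{i_0}$ is the sum of a polynomial of degree $<h_{i_0}$ and a (possibly trivial) term of degree $p$ in case (i), or of degree $4$ in case (ii).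
   Context: $k$ is the residue field of $K$, $\mathfrak{S}=W(k)[[u]]$ with Frobenius $\varphi$ (Witt Frobenius, $u\mapsto u^p$); $E/\mathbb{Q}_p$ is a finite extension containing all embeddings of $K$, with residue field $k_E$. Fix $\kappa_0\colon K\to E$ and define $\kappa_{s+1}$ by $\kappa_{s+1}^p\equiv\kappa_s\pmod p$ (indices mod $f$); $\varepsilon_s$ is the idempotent of $W(k)\otimes_{\mathbb{Z}_p}\mathcal{O}_E$ with $(x\otimes1)\varepsilon_s=(1\otimes\kappa_s(x))\varepsilon_s$, and for a module $M$ over $\mathfrak{S}\otimes k_E$, $M_s=\varepsilon_sM$ (a $k_E[[u]]$-module); $\varphi$ maps $M_{s-1}$ to $M_s$. $(a)_i=a$ if $i\equiv0\pmod f$ and $1$ otherwise. For non-negative integers $s_0,\dots,s_{f-1}$ and $a\in k_E^\times$, $\overline{\mathfrak{M}}(s_0,\dots,s_{f-1};a)$ is the rank one $\varphi$-module over $\mathfrak{S}\otimes_{\mathbb{Z}_p}k_E$ whose $i$-th component is generated by $e_i$, with $\varphi(e_{i-1})=(a)_iu^{s_i}e_i$. $\mathcal{P}$ is the set of $f$-tuples $(r_0,\dots,r_{f-1})$ with all $r_i\in\{1,p-1,p\}$ such that $r_i=p$ implies $r_{i+1}=1$, and $r_i\in\{1,p-1\}$ implies $r_{i+1}\in\{p-1,p\}$ (with $r_f=r_0$). A polynomial of degree $<0$ means $0$. -}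

module Defs where

open import Level using (Level; _⊔_)
open import Data.Nat as ℕ using (ℕ; zero; suc; _≤_; _∸_; _^_)
open import Data.Fin using (Fin; zero; suc; fromℕ; inject₁; toℕ; fromℕ<)
open import Data.Sum using (_⊎_)
open import Data.Fin.Subset using (Subset; _∈_)
open import Data.Vec using (lookup)
open import Data.Bool using (Bool; true; false; if_then_else_)
open import Data.Product using (Σ; ∃; _×_; _,_)
open import Relation.Nullary using (¬_; does; yes; no)
open import Relation.Binary.PropositionalEquality using (_≡_; _≢_)
open import Function.Bundles using (_⇔_)
open import Algebra.Bundles using (CommutativeRing)

prev : ∀ {n} → Fin n → Fin n
prev {suc n} zero    = fromℕ n
prev {suc n} (suc i) = inject₁ i

next : ∀ {n} → Fin n → Fin n
next {suc n} i with toℕ i ℕ.<? n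
... | yes i<n = suc (fromℕ< i<n)
... | no _    = zero

hOf : ∀ {f} → (Fin f → ℕ) → Subset f → Fin f → ℕ
hOf r J i = if lookup J i then r i else 0

InP : ∀ {f} → ℕ → (Fin f → ℕ) → Set
InP {f} p r =
  (∀ i → (r i ≡ 1 ⊎ r i ≡ p ∸ 1) ⊎ r i ≡ p)
  × (∀ i → r i ≡ p → r (next i) ≡ 1)
  × (∀ i → (r i ≡ 1 ⊎ r i ≡ p ∸ 1) → (r (next i) ≡ p ∸ 1 ⊎ r (next i) ≡ p))

module _ {c ℓ : Level} (R : CommutativeRing c ℓ) where
  open CommutativeRing R

  IsField : Set (c ⊔ ℓ)
  IsField = (¬ (1# ≈ 0#)) × (∀ x → ¬ (x ≈ 0#) → ∃ λ y → x * y ≈ 1#)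

  natMul : ℕ → Carrier → Carrier
  natMul zero    x = 0#
  natMul (suc n) x = x + natMul n x

  HasCharDividing : ℕ → Set ℓ
  HasCharDividing p = natMul p 1# ≈ 0#

  HasCardinality : ℕ → Set (c ⊔ ℓ)
  HasCardinality N =
    Σ (Fin N → Carrier) λ en →
      (∀ x → ∃ λ i → en i ≈ x) × (∀ i j → en i ≈ en j → i ≡ j)

module Phi {c ℓ : Level} (R : CommutativeRing c ℓ) where
  open CommutativeRing R

  PS : Set c
  PS = ℕ → Carrier

  _≈ₚ_ : PS → PS → Set ℓ
  F ≈ₚ G = ∀ n → F n ≈ G n

  sumUpTo : (ℕ → Carrier) → ℕ → Carrier
  sumUpTo g zero    = g 0
  sumUpTo g (suc n) = sumUpTo g n + g (suc n)

  _+ₚ_ : PS → PS → PS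
  (F +ₚ G) n = F n + G n

  _*ₚ_ : PS → PS → PS
  (F *ₚ G) n = sumUpTo (λ k → F k * G (n ∸ k)) n

  zeroₚ oneₚ : PS
  zeroₚ n = 0#
  oneₚ zero    = 1#
  oneₚ (suc n) = 0#

  mono : Carrier → ℕ → PS
  mono x k n = if does (n ℕ.≟ k) then x else 0#

  -- φ on k_E[[u]] (k_E-linear, u ↦ u^p):  φ(F)_n = F_{n/p} if p ∣ n, else 0
  frob : ℕ → PS → PS
  frob p F n = sumUpTo (λ m → if does (m ℕ.* p ℕ.≟ n) then F m else 0#) n

  tw : ∀ {f} → Carrier → Fin f → Carrier
  tw a zero    = a
  tw a (suc i) = 1#

  -- elements of M_i: coordinates (α , β) meaning α e_i + β f_i, where
  -- (e_i , f_i) is the basis in which M is the extension with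
  --   φ(e_{i-1}) = (b)_i u^{r_i-h_i} e_i,
  --   φ(f_{i-1}) = (a)_i u^{h_i} f_i + y_i e_i.
  Elt : Set c
  Elt = PS × PS

  _≈ₑ_ : Elt → Elt → Set ℓ
  (α , β) ≈ₑ (α' , β') = (α ≈ₚ α') × (β ≈ₚ β')

  _·ₑ_ : PS → Elt → Elt
  λ' ·ₑ (α , β) = (λ' *ₚ α , λ' *ₚ β)

  _+ₑ_ : Elt → Elt → Elt
  (α , β) +ₑ (α' , β') = (α +ₚ α' , β +ₚ β')

  phiExt : ∀ {f} (p : ℕ) (r h : Fin f → ℕ) (a b : Carrier) (y : Fin f → PS) →
           Fin f → Elt → Elt
  phiExt p r h a b y i (α , β) =
    ( (frob p α *ₚ mono (tw b i) (r i ∸ h i)) +ₚ (frob p β *ₚ y i)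
    , frob p β *ₚ mono (tw a i) (h i) )

  -- (E , F) is a basis (generating pair) of the free rank two module M_i:
  -- the coordinate matrix [E F] is invertible over k_E[[u]]
  IsBasis : Elt → Elt → Set (c ⊔ ℓ)
  IsBasis (e₁ , e₂) (f₁ , f₂) =
    Σ PS λ n₁₁ → Σ PS λ n₁₂ → Σ PS λ n₂₁ → Σ PS λ n₂₂ →
      (((e₁ *ₚ n₁₁) +ₚ (f₁ *ₚ n₂₁)) ≈ₚ oneₚ) × (((e₁ *ₚ n₁₂) +ₚ (f₁ *ₚ n₂₂)) ≈ₚ zeroₚ)
      × (((e₂ *ₚ n₁₁) +ₚ (f₂ *ₚ n₂₁)) ≈ₚ zeroₚ) × (((e₂ *ₚ n₁₂) +ₚ (f₂ *ₚ n₂₂)) ≈ₚ oneₚ)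
      × (((n₁₁ *ₚ e₁) +ₚ (n₁₂ *ₚ e₂)) ≈ₚ oneₚ) × (((n₁₁ *ₚ f₁) +ₚ (n₁₂ *ₚ f₂)) ≈ₚ zeroₚ)
      × (((n₂₁ *ₚ e₁) +ₚ (n₂₂ *ₚ e₂)) ≈ₚ zeroₚ) × (((n₂₁ *ₚ f₁) +ₚ (n₂₂ *ₚ f₂)) ≈ₚ oneₚ)

  PolyDeg< : ℕ → PS → Set ℓ
  PolyDeg< h x = ∀ n → h ≤ n → x n ≈ 0#

  PolyDeg<Plus : ℕ → ℕ → PS → Set ℓ
  PolyDeg<Plus h d x = ∀ n → h ≤ n → n ≢ d → x n ≈ 0#

  HasNormalForm : ∀ {f} (p : ℕ) (r h : Fin f → ℕ) (a b : Carrier) (y : Fin f → PS) →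
                  (Fin f → PS → Set ℓ) → Set (c ⊔ ℓ)
  HasNormalForm {f} p r h a b y Good =
    Σ (Fin f → Elt) λ e' → Σ (Fin f → Elt) λ f' → Σ (Fin f → PS) λ x →
      (∀ i → IsBasis (e' i) (f' i))
      × (∀ i → phiExt p r h a b y i (e' (prev i)) ≈ₑ (mono (tw b i) (r i ∸ h i) ·ₑ e' i))
      × (∀ i → phiExt p r h a b y i (f' (prev i))
                 ≈ₑ ((mono (tw a i) (h i) ·ₑ f' i) +ₑ (x i ·ₑ e' i)))
      × (∀ i → Good i (x i))

-- Replacing f_i by f_i + Λ_i e_i turns the extension coefficient y_i into
--   x_i = y_i + (b)_i u^{s_i} φ(Λ_{i-1}) - (a)_i u^{h_i} Λ_i,   where s_i = r_i - h_i,
-- so the coefficient of u^{m+h_i} in x_i vanishes exactly when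
--   (a)_i Λ_i(m) = y_i(m+h_i) + (b)_i Λ_{i-1}(k)   (the last term only if k p + s_i = m + h_i).
-- Read as a recursion (i, m) ← (i-1, k) this is well founded except along cycles of such steps, and
-- these have m_i = lowDeg r_i ∈ {0, 1} for all i, or m_i = 2 for all i; a cycle of the first kind forces
-- (r, J) to be as in case (i), one of the second kind as in case (ii). A cycle is cut at one point,
-- where Λ takes a free value Z. Cutting at index 0, the value returning around the cycle is β + Z with
-- β independent of Z, so the equation at the cut reads a Z = b (β + Z) + y: solvable when a ≠ b.
-- Otherwise the cut leaves one extra term in x_{i₀}, of degree lowDeg r_{i₀} + h_{i₀} = p in case (i)
-- and 2 + h_{i₀} = 4 in case (ii).

module Submission where

open import Defs
open import Level using (Level)
open import Data.Nat using (ℕ; zero; suc; _+_; _*_; _∸_; _^_; _≤_; _<_; _≟_; _≤?_; z≤n; s≤s; NonZero)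
import Data.Nat.Properties as ℕ
open import Data.Nat.Divisibility using (_∣?_; divides)
open import Data.Nat.Primality using (Prime; ¬prime[0]; ¬prime[1])
open import Data.Fin using (Fin; zero; suc; toℕ; fromℕ; inject₁)
import Data.Fin.Properties as Fin
open import Data.Fin.Subset using (Subset; _∈_)
open import Data.Vec using (lookup)
import Data.Vec.Properties as Vec
open import Data.Bool using (true; false; if_then_else_)
open import Data.Bool.Properties using (if-eta)
open import Data.Empty using (⊥; ⊥-elim)
open import Data.Product using (∃; _×_; _,_; proj₁; proj₂)
open import Data.Sum using (_⊎_; inj₁; inj₂; swap)
open import Relation.Nullary using (¬_; Dec; yes; no; does; contradiction)
open import Relation.Nullary.Decidable using (dec-true; dec-false; _×-dec_)
open import Relation.Binary.PropositionalEquality as ≡ using (_≡_; _≢_)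
open import Function using (_∘_; id)
open import Function.Bundles using (_⇔_; mk⇔; Equivalence)
open import Algebra.Bundles using (CommutativeRing)

module Grid (p : ℕ) .{{_ : NonZero p}} where
  open ≡ using (sym; trans; cong; subst)

  grid? : ∀ s n → Dec (∃ λ k → k * p + s ≡ n)
  grid? s n with s ≤? n | p ∣? (n ∸ s)
  ... | no s≰n | _ = no λ (k , e) → s≰n (subst (s ≤_) e (ℕ.m≤n+m s (k * p)))
  ... | yes _ | no p∤ = no λ (k , e) →
    p∤ (divides k (trans (cong (_∸ s) (sym e)) (ℕ.m+n∸n≡m (k * p) s)))
  ... | yes s≤n | yes (divides k e) = yes (k , trans (cong (_+ s) (sym e)) (ℕ.m∸n+n≡m s≤n))

module PowerSeries {c ℓ : Level} (R : CommutativeRing c ℓ) where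
  open CommutativeRing R hiding (zero) renaming (_+_ to _⊕_; _*_ to _·_)
  open Phi R

  -ₚ_ : PS → PS
  (-ₚ F) n = - F n

  if-yes : ∀ {a} {A : Set a} (d : Dec A) {x y : Carrier} → A → (if does d then x else y) ≈ x
  if-yes (yes _) _ = refl
  if-yes (no ¬A) A = ⊥-elim (¬A A)

  if-no : ∀ {a} {A : Set a} (d : Dec A) {x y : Carrier} → ¬ A → (if does d then x else y) ≈ y
  if-no (yes A) ¬A = ⊥-elim (¬A A)
  if-no (no _) _ = refl

  sumUpTo-cong : ∀ {g g′} n → (∀ k → k ≤ n → g k ≈ g′ k) → sumUpTo g n ≈ sumUpTo g′ n
  sumUpTo-cong zero eq = eq 0 z≤n
  sumUpTo-cong (suc n) eq =
    +-cong (sumUpTo-cong n (λ k k≤n → eq k (ℕ.m≤n⇒m≤1+n k≤n))) (eq (suc n) ℕ.≤-refl)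

  sumUpTo-zero : ∀ {g} n → (∀ k → k ≤ n → g k ≈ 0#) → sumUpTo g n ≈ 0#
  sumUpTo-zero zero eq = eq 0 z≤n
  sumUpTo-zero (suc n) eq =
    trans (+-cong (sumUpTo-zero n (λ k k≤n → eq k (ℕ.m≤n⇒m≤1+n k≤n))) (eq (suc n) ℕ.≤-refl))
          (+-identityʳ 0#)

  sumUpTo-single : ∀ {g} n {j} → j ≤ n → (∀ k → k ≤ n → k ≢ j → g k ≈ 0#) → sumUpTo g n ≈ g j
  sumUpTo-single zero z≤n _ = refl
  sumUpTo-single (suc n) {j} j≤1+n eq with j ≟ suc n
  ... | yes ≡.refl = trans (+-congʳ (sumUpTo-zero n λ k k≤n → eq k (ℕ.m≤n⇒m≤1+n k≤n) (ℕ.<⇒≢ (s≤s k≤n))))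
                         (+-identityˡ _)
  ... | no j≢1+n = trans (+-cong (sumUpTo-single n (ℕ.≤-pred (ℕ.≤∧≢⇒< j≤1+n j≢1+n))
                                                   (λ k k≤n → eq k (ℕ.m≤n⇒m≤1+n k≤n)))
                                 (eq (suc n) ℕ.≤-refl (j≢1+n ∘ ≡.sym)))
                         (+-identityʳ _)

  mono-self : ∀ x k → mono x k k ≈ x
  mono-self x k = if-yes (k ≟ k) ≡.refl

  mono-≢ : ∀ x k {n} → n ≢ k → mono x k n ≈ 0#
  mono-≢ x k {n} n≢k = if-no (n ≟ k) n≢k

  *ₚ-cong : ∀ {F F′ G G′} → F ≈ₚ F′ → G ≈ₚ G′ → (F *ₚ G) ≈ₚ (F′ *ₚ G′)
  *ₚ-cong F≈F′ G≈G′ n = sumUpTo-cong n (λ k _ → *-cong (F≈F′ k) (G≈G′ (n ∸ k)))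

  *ₚ-congʳ : ∀ {F F′} G → F ≈ₚ F′ → (F *ₚ G) ≈ₚ (F′ *ₚ G)
  *ₚ-congʳ G F≈F′ = *ₚ-cong {G = G} F≈F′ (λ _ → refl)

  *ₚ-zeroˡ : ∀ F → (zeroₚ *ₚ F) ≈ₚ zeroₚ
  *ₚ-zeroˡ F n = sumUpTo-zero n (λ k _ → zeroˡ _)

  *ₚ-zeroʳ : ∀ F → (F *ₚ zeroₚ) ≈ₚ zeroₚ
  *ₚ-zeroʳ F n = sumUpTo-zero n (λ k _ → zeroʳ _)

  *ₚ-identityˡ : ∀ F → (oneₚ *ₚ F) ≈ₚ F
  *ₚ-identityˡ F n = trans (sumUpTo-single n z≤n λ { zero _ 0≢0 → ⊥-elim (0≢0 ≡.refl)
                                                  ; (suc k) _ _ → zeroˡ _ })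
                           (*-identityˡ _)

  *ₚ-identityʳ : ∀ F → (F *ₚ oneₚ) ≈ₚ F
  *ₚ-identityʳ F n = trans (sumUpTo-single n ℕ.≤-refl off) (trans (*-congˡ one-at-0) (*-identityʳ _))
    where
    one-at-0 : oneₚ (n ∸ n) ≈ 1#
    one-at-0 = reflexive (≡.cong oneₚ (ℕ.n∸n≡0 n))
    off : ∀ k → k ≤ n → k ≢ n → F k · oneₚ (n ∸ k) ≈ 0#
    off k k≤n k≢n with n ∸ k in eq
    ... | zero = ⊥-elim (k≢n (ℕ.≤-antisym k≤n (ℕ.m∸n≡0⇒m≤n eq)))
    ... | suc _ = zeroʳ _

  *ₚ-mono : ∀ F x s {n} → s ≤ n → (F *ₚ mono x s) n ≈ F (n ∸ s) · x
  *ₚ-mono F x s {n} s≤n = trans (sumUpTo-single n (ℕ.m∸n≤m n s) off) (*-congˡ at)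
    where
    at : mono x s (n ∸ (n ∸ s)) ≈ x
    at = trans (reflexive (≡.cong (mono x s) (ℕ.m∸[m∸n]≡n s≤n))) (mono-self x s)
    off : ∀ k → k ≤ n → k ≢ n ∸ s → F k · mono x s (n ∸ k) ≈ 0#
    off k k≤n k≢ = trans (*-congˡ (mono-≢ x s {n ∸ k} λ e →
      k≢ (≡.trans (≡.sym (ℕ.m∸[m∸n]≡n k≤n)) (≡.cong (n ∸_) e)))) (zeroʳ _)

  *ₚ-mono-< : ∀ F x s {n} → n < s → (F *ₚ mono x s) n ≈ 0#
  *ₚ-mono-< F x s {n} n<s = sumUpTo-zero n λ k _ →
    trans (*-congˡ (mono-≢ x s λ e → ℕ.<-irrefl e (ℕ.≤-<-trans (ℕ.m∸n≤m n k) n<s))) (zeroʳ _)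

  mono-*ₚ : ∀ F x s m → (mono x s *ₚ F) (m + s) ≈ x · F m
  mono-*ₚ F x s m = trans (sumUpTo-single (m + s) (ℕ.m≤n+m s m) off)
                          (*-cong (mono-self x s) (reflexive (≡.cong F (ℕ.m+n∸n≡m m s))))
    where
    off : ∀ k → k ≤ m + s → k ≢ s → mono x s k · F (m + s ∸ k) ≈ 0#
    off k _ k≢s = trans (*-congʳ (mono-≢ x s k≢s)) (zeroˡ _)

  module _ (p : ℕ) .{{_ : NonZero p}} where

    frob-* : ∀ F k → frob p F (k * p) ≈ F k
    frob-* F k = trans (sumUpTo-single (k * p) (ℕ.m≤m*n k p) off) (if-yes (k * p ≟ k * p) ≡.refl)
      where
      off : ∀ m → m ≤ k * p → m ≢ k → (if does (m * p ≟ k * p) then F m else 0#) ≈ 0#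
      off m _ m≢k = if-no (m * p ≟ k * p) (m≢k ∘ ℕ.*-cancelʳ-≡ m k p)

    frob-off : ∀ F {n} → (∀ k → k * p ≢ n) → frob p F n ≈ 0#
    frob-off F {n} off = sumUpTo-zero n λ m _ → if-no (m * p ≟ n) (off m)

    frob-zeroₚ : frob p zeroₚ ≈ₚ zeroₚ
    frob-zeroₚ n = sumUpTo-zero n λ m _ → reflexive (if-eta (does (m * p ≟ n)))

    frob-oneₚ : frob p oneₚ ≈ₚ oneₚ
    frob-oneₚ zero = refl
    frob-oneₚ (suc n) = sumUpTo-zero (suc n) off
      where
      off : ∀ m → m ≤ suc n → (if does (m * p ≟ suc n) then oneₚ m else 0#) ≈ 0#
      off zero _ = refl
      off (suc m) _ = reflexive (if-eta (does (suc m * p ≟ suc n)))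

    frob-oneₚ-*ₚ : ∀ G → (frob p oneₚ *ₚ G) ≈ₚ G
    frob-oneₚ-*ₚ G n = trans (*ₚ-congʳ G frob-oneₚ n) (*ₚ-identityˡ G n)

    frob-zeroₚ-*ₚ : ∀ G → (frob p zeroₚ *ₚ G) ≈ₚ zeroₚ
    frob-zeroₚ-*ₚ G n = trans (*ₚ-congʳ G frob-zeroₚ n) (*ₚ-zeroˡ G n)

    open Grid p

    frob-*ₚ-mono : ∀ F x s {k n} → k * p + s ≡ n → (frob p F *ₚ mono x s) n ≈ F k · x
    frob-*ₚ-mono F x s {k} ≡.refl = trans (*ₚ-mono (frob p F) x s (ℕ.m≤n+m s (k * p)))
                                          (*-congʳ (trans (reflexive (≡.cong (frob p F) (ℕ.m+n∸n≡m (k * p) s)))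
                                                          (frob-* F k)))

    frob-*ₚ-mono-off : ∀ F x s {n} → ¬ (∃ λ k → k * p + s ≡ n) → (frob p F *ₚ mono x s) n ≈ 0#
    frob-*ₚ-mono-off F x s {n} off with s ≤? n
    ... | no s≰n = *ₚ-mono-< (frob p F) x s (ℕ.≰⇒> s≰n)
    ... | yes s≤n = trans (*ₚ-mono (frob p F) x s s≤n)
                          (trans (*-congʳ (frob-off F λ k e → off (k , onGrid {k} e))) (zeroˡ x))
      where
      onGrid : ∀ {k} → k * p ≡ n ∸ s → k * p + s ≡ n
      onGrid e = ≡.trans (≡.cong (_+ s) e) (ℕ.m∸n+n≡m s≤n)

  unitriangular-isBasis : ∀ L → IsBasis (oneₚ , zeroₚ) (L , oneₚ)
  unitriangular-isBasis L = oneₚ , -ₚ L , zeroₚ , oneₚ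
    , (λ k → trans (+-cong (*ₚ-identityˡ oneₚ k) (*ₚ-zeroʳ L k)) (+-identityʳ _))
    , (λ k → trans (+-cong (*ₚ-identityˡ (-ₚ L) k) (*ₚ-identityʳ L k)) (-‿inverseˡ _))
    , (λ k → trans (+-cong (*ₚ-zeroˡ oneₚ k) (*ₚ-zeroʳ oneₚ k)) (+-identityʳ _))
    , (λ k → trans (+-cong (*ₚ-zeroˡ (-ₚ L) k) (*ₚ-identityˡ oneₚ k)) (+-identityˡ _))
    , (λ k → trans (+-cong (*ₚ-identityˡ oneₚ k) (*ₚ-zeroʳ (-ₚ L) k)) (+-identityʳ _))
    , (λ k → trans (+-cong (*ₚ-identityˡ L k) (*ₚ-identityʳ (-ₚ L) k)) (-‿inverseʳ _))
    , (λ k → trans (+-cong (*ₚ-zeroˡ oneₚ k) (*ₚ-identityˡ zeroₚ k)) (+-identityʳ _))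
    , (λ k → trans (+-cong (*ₚ-zeroˡ L k) (*ₚ-identityˡ oneₚ k)) (+-identityˡ _))

  PolyDeg<-intro : ∀ {h x} → (∀ m → x (m + h) ≈ 0#) → PolyDeg< h x
  PolyDeg<-intro {h} {x} vanish k h≤k =
    trans (reflexive (≡.cong x (≡.sym (ℕ.m∸n+n≡m h≤k)))) (vanish (k ∸ h))

  PolyDeg<Plus-intro : ∀ {h d x} m₀ → m₀ + h ≡ d → (∀ m → m ≢ m₀ → x (m + h) ≈ 0#) →
                       PolyDeg<Plus h d x
  PolyDeg<Plus-intro {h} {d} {x} m₀ m₀+h≡d vanish k h≤k k≢d =
    trans (reflexive (≡.cong x (≡.sym (ℕ.m∸n+n≡m h≤k))))
          (vanish (k ∸ h) λ e → k≢d (≡.trans (≡.sym (ℕ.m∸n+n≡m h≤k))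
                                             (≡.trans (≡.cong (_+ h) e) m₀+h≡d)))

module Arithmetic (q : ℕ) where
  open ≡ using (refl; sym; trans; cong; subst)
  open ℕ.≤-Reasoning

  p : ℕ
  p = 2 + q

  2≤p : 2 ≤ p
  2≤p = s≤s (s≤s z≤n)

  data Weights (r : ℕ) : ℕ → ℕ → Set where
    inJ  : Weights r r 0
    outJ : Weights r 0 r

  -- u^s φ(u^k) = u^{m+h}: the coefficient Λ_{i-1}(k) enters the equation for Λ_i(m).
  Step : (s h m k : ℕ) → Set
  Step s h m k = k * p + s ≡ m + h

  lowDeg : ℕ → ℕ
  lowDeg r = if does (r ≟ p) then 0 else 1

  lowDeg-≡p : ∀ {r} → r ≡ p → lowDeg r ≡ 0
  lowDeg-≡p {r} r≡p = cong (λ b → if b then 0 else 1) (dec-true (r ≟ p) r≡p)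

  lowDeg-≢p : ∀ {r} → r ≢ p → lowDeg r ≡ 1
  lowDeg-≢p {r} r≢p = cong (λ b → if b then 0 else 1) (dec-false (r ≟ p) r≢p)

  lowDeg≤1 : ∀ r → lowDeg r ≤ 1
  lowDeg≤1 r with does (r ≟ p)
  ... | true  = z≤n
  ... | false = s≤s z≤n

  small≢p : ∀ {r} → r ≡ 1 ⊎ r ≡ p ∸ 1 → r ≢ p
  small≢p (inj₁ refl) ()
  small≢p (inj₂ refl) = ℕ.<⇒≢ (ℕ.n<1+n (suc q))

  lowDeg+large≡p : ∀ {r} → r ≡ p ∸ 1 ⊎ r ≡ p → lowDeg r + r ≡ p
  lowDeg+large≡p (inj₁ refl) = cong (_+ suc q) (lowDeg-≢p (small≢p (inj₂ refl)))
  lowDeg+large≡p (inj₂ refl) = cong (_+ p) (lowDeg-≡p refl)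

  half< : ∀ {k m} → 2 * k ≤ m → 0 < m → k < m
  half< {k} {m} 2k≤m 0<m =
    ℕ.*-cancelˡ-< 2 k m (ℕ.≤-<-trans 2k≤m (ℕ.m<m+n m (ℕ.<-≤-trans 0<m (ℕ.m≤m+n m 0))))

  1*p+0≡p : 1 * p + 0 ≡ p
  1*p+0≡p = trans (ℕ.+-identityʳ (1 * p)) (ℕ.*-identityˡ p)

  2*k≤k*p : ∀ k → 2 * k ≤ k * p
  2*k≤k*p k = begin
    2 * k ≡⟨ ℕ.*-comm 2 k ⟩
    k * 2 ≤⟨ ℕ.*-monoʳ-≤ k 2≤p ⟩
    k * p ∎

  step-src-bound : ∀ {r h s m k} → Weights r h s → r ≤ p → Step s h m k → 2 * k ≤ 2 + m
  step-src-bound {r} {m = m} {k} outJ _ st = begin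
    2 * k      ≤⟨ 2*k≤k*p k ⟩
    k * p      ≤⟨ ℕ.m≤m+n (k * p) r ⟩
    k * p + r  ≡⟨ st ⟩
    m + 0      ≡⟨ ℕ.+-identityʳ m ⟩
    m          ≤⟨ ℕ.m≤n+m m 2 ⟩
    2 + m      ∎
  step-src-bound {k = zero} inJ _ _ = z≤n
  step-src-bound {r} {m = m} {suc k} inJ r≤p st = begin
    2 * suc k  ≡⟨ ℕ.*-suc 2 k ⟩
    2 + 2 * k  ≤⟨ ℕ.+-monoʳ-≤ 2 (ℕ.≤-trans (2*k≤k*p k) k*p≤m) ⟩
    2 + m      ∎
    where
    k*p≤m : k * p ≤ m
    k*p≤m = ℕ.+-cancelˡ-≤ p (k * p) m (begin
      p + k * p      ≡⟨ sym (ℕ.+-identityʳ (suc k * p)) ⟩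
      suc k * p + 0  ≡⟨ st ⟩
      m + r          ≤⟨ ℕ.+-monoʳ-≤ m r≤p ⟩
      m + p          ≡⟨ ℕ.+-comm m p ⟩
      p + m          ∎)

  step-lowDeg : ∀ {r h s m k} → Weights r h s → 1 ≤ r → m ≤ 1 → k ≤ 1 → Step s h m k → m ≡ lowDeg r
  step-lowDeg outJ 1≤r z≤n z≤n st = contradiction (sym st) (ℕ.<⇒≢ 1≤r)
  step-lowDeg outJ _ z≤n (s≤s z≤n) ()
  step-lowDeg outJ _ (s≤s z≤n) z≤n refl = refl
  step-lowDeg outJ _ (s≤s z≤n) (s≤s z≤n) ()
  step-lowDeg inJ 1≤r z≤n z≤n st = contradiction st (ℕ.<⇒≢ 1≤r)
  step-lowDeg inJ _ z≤n (s≤s z≤n) st = sym (lowDeg-≡p (trans (sym st) 1*p+0≡p))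
  step-lowDeg inJ _ (s≤s z≤n) z≤n ()
  step-lowDeg inJ _ (s≤s z≤n) (s≤s z≤n) st =
    sym (lowDeg-≢p λ r≡p → ℕ.1+n≢n (sym (trans (sym 1*p+0≡p) (trans st (cong suc r≡p)))))

  lowStep-from-0 : ∀ {r h s} → Weights r h s → 1 ≤ r → Step s h (lowDeg r) 0 → h ≡ 0 × r ≡ 1
  lowStep-from-0 {r} outJ 1≤r st =
    refl , ℕ.≤-antisym (ℕ.≤-trans (ℕ.≤-reflexive (trans st (ℕ.+-identityʳ _))) (lowDeg≤1 r)) 1≤r
  lowStep-from-0 {r} inJ 1≤r st = contradiction (ℕ.m+n≡0⇒n≡0 (lowDeg r) (sym st)) (ℕ.<⇒≢ 1≤r ∘ sym)

  lowStep-from-1 : ∀ {r h s} → Weights r h s → Step s h (lowDeg r) 1 → h ≡ r × (r ≡ p ⊎ r ≡ p ∸ 1)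
  lowStep-from-1 {r} outJ st = contradiction (sym st) (ℕ.<⇒≢ (begin-strict
    lowDeg r + 0  ≡⟨ ℕ.+-identityʳ (lowDeg r) ⟩
    lowDeg r      ≤⟨ lowDeg≤1 r ⟩
    1             <⟨ s≤s (s≤s z≤n) ⟩
    1 * p + r     ∎))
  lowStep-from-1 {r} inJ st with r ≟ p
  ... | yes r≡p = refl , inj₁ r≡p
  ... | no r≢p = refl , inj₂ (cong (_∸ 1) (sym p≡1+r))
    where
    p≡1+r : p ≡ suc r
    p≡1+r = trans (sym 1*p+0≡p) (trans st (cong (_+ r) (lowDeg-≢p r≢p)))

  twoStep-shape : ∀ {r h s} → Weights r h s → r ≤ p → Step s h 2 2 → p ≡ 2 × r ≡ 2 × h ≡ r
  twoStep-shape {r} outJ _ st = contradiction 4≤2 (ℕ.<⇒≱ (ℕ.n≤1+n 3))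
    where
    4≤2 : 4 ≤ 2
    4≤2 = begin
      4          ≤⟨ ℕ.*-monoʳ-≤ 2 2≤p ⟩
      2 * p      ≤⟨ ℕ.m≤m+n (2 * p) r ⟩
      2 * p + r  ≡⟨ st ⟩
      2          ∎
  twoStep-shape {r} inJ r≤p st = p≡2 , r≡2 , refl
    where
    2*p≡2+r : 2 * p ≡ 2 + r
    2*p≡2+r = trans (sym (ℕ.+-identityʳ (2 * p))) st
    p≤2 : p ≤ 2
    p≤2 = ℕ.+-cancelʳ-≤ p p 2 (begin
      p + p      ≡⟨ cong (p +_) (sym (ℕ.+-identityʳ p)) ⟩
      2 * p      ≡⟨ 2*p≡2+r ⟩
      2 + r      ≤⟨ ℕ.+-monoʳ-≤ 2 r≤p ⟩
      2 + p      ∎)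
    p≡2 : p ≡ 2
    p≡2 = ℕ.≤-antisym p≤2 2≤p
    r≡2 : r ≡ 2
    r≡2 = ℕ.+-cancelˡ-≡ 2 r 2 (trans (sym 2*p≡2+r) (cong (2 *_) p≡2))

module Cyclic (n : ℕ) where
  open ≡ using (refl; sym; trans; cong)

  prev-next : ∀ (i : Fin (suc n)) → prev (next i) ≡ i
  prev-next i with toℕ i ℕ.<? n
  ... | yes i<n = Fin.toℕ-injective (trans (Fin.toℕ-inject₁ _) (Fin.toℕ-fromℕ< i<n))
  ... | no i≮n = Fin.toℕ-injective (trans (Fin.toℕ-fromℕ n)
                                          (ℕ.≤-antisym (ℕ.≮⇒≥ i≮n) (ℕ.≤-pred (Fin.toℕ<n i))))

  next-prev : ∀ (i : Fin (suc n)) → next (prev i) ≡ i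
  next-prev zero with toℕ (fromℕ n) ℕ.<? n
  ... | yes n<n = contradiction (Fin.toℕ-fromℕ n) (ℕ.<⇒≢ n<n)
  ... | no _ = refl
  next-prev (suc i) with toℕ (inject₁ i) ℕ.<? n
  ... | yes i<n = cong suc (Fin.toℕ-injective (trans (Fin.toℕ-fromℕ< i<n) (Fin.toℕ-inject₁ i)))
  ... | no i≮n = contradiction (ℕ.≤-trans (ℕ.≤-reflexive (cong suc (Fin.toℕ-inject₁ i))) (Fin.toℕ<n i)) i≮n

  gapℕ : ℕ → ℕ → ℕ
  gapℕ a x with a ≤? x
  ... | yes _ = x ∸ a
  ... | no _ = suc n + x ∸ a

  gapℕ-≤ : ∀ {a x} → a ≤ x → gapℕ a x ≡ x ∸ a
  gapℕ-≤ {a} {x} a≤x with a ≤? x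
  ... | yes _ = refl
  ... | no a≰x = contradiction a≤x a≰x

  gapℕ-> : ∀ {a x} → x < a → gapℕ a x ≡ suc n + x ∸ a
  gapℕ-> {a} {x} x<a with a ≤? x
  ... | yes a≤x = contradiction a≤x (ℕ.<⇒≱ x<a)
  ... | no _ = refl

  -- the number of prev-steps from i back to j
  gap : Fin (suc n) → Fin (suc n) → ℕ
  gap j i = gapℕ (toℕ j) (toℕ i)

  gap≤n : ∀ j i → gap j i ≤ n
  gap≤n j i with toℕ j ≤? toℕ i
  ... | yes _ = ℕ.≤-trans (ℕ.m∸n≤m (toℕ i) (toℕ j)) (ℕ.≤-pred (Fin.toℕ<n i))
  ... | no j≰i = ℕ.≤-trans (ℕ.∸-monoʳ-≤ (suc n + toℕ i) (ℕ.≰⇒> j≰i))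
                           (ℕ.≤-reflexive (ℕ.m+n∸n≡m n (toℕ i)))

  gap-prev : ∀ j i → i ≢ j → suc (gap j (prev i)) ≡ gap j i
  gap-prev j zero 0≢j = begin
    suc (gapℕ (toℕ j) (toℕ (fromℕ n))) ≡⟨ cong (suc ∘ gapℕ (toℕ j)) (Fin.toℕ-fromℕ n) ⟩
    suc (gapℕ (toℕ j) n)               ≡⟨ cong suc (gapℕ-≤ j≤n) ⟩
    suc (n ∸ toℕ j)                    ≡⟨ sym (ℕ.+-∸-assoc 1 j≤n) ⟩
    suc n ∸ toℕ j                      ≡⟨ cong (_∸ toℕ j) (sym (ℕ.+-identityʳ (suc n))) ⟩
    suc n + 0 ∸ toℕ j                  ≡⟨ sym (gapℕ-> 0<j) ⟩
    gapℕ (toℕ j) 0                     ∎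
    where
    open ≡.≡-Reasoning
    j≤n : toℕ j ≤ n
    j≤n = ℕ.≤-pred (Fin.toℕ<n j)
    0<j : 0 < toℕ j
    0<j = ℕ.n≢0⇒n>0 λ j≡0 → 0≢j (sym (Fin.toℕ-injective j≡0))
  gap-prev j (suc i) 1+i≢j with toℕ j ≤? toℕ i
  ... | yes j≤i = begin
    suc (gapℕ (toℕ j) (toℕ (inject₁ i))) ≡⟨ cong (suc ∘ gapℕ (toℕ j)) (Fin.toℕ-inject₁ i) ⟩
    suc (gapℕ (toℕ j) (toℕ i))           ≡⟨ cong suc (gapℕ-≤ j≤i) ⟩
    suc (toℕ i ∸ toℕ j)                  ≡⟨ sym (ℕ.+-∸-assoc 1 j≤i) ⟩
    suc (toℕ i) ∸ toℕ j                  ≡⟨ sym (gapℕ-≤ (ℕ.m≤n⇒m≤1+n j≤i)) ⟩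
    gapℕ (toℕ j) (suc (toℕ i))           ∎
    where open ≡.≡-Reasoning
  ... | no j≰i = begin
    suc (gapℕ (toℕ j) (toℕ (inject₁ i))) ≡⟨ cong (suc ∘ gapℕ (toℕ j)) (Fin.toℕ-inject₁ i) ⟩
    suc (gapℕ (toℕ j) (toℕ i))           ≡⟨ cong suc (gapℕ-> (ℕ.≰⇒> j≰i)) ⟩
    suc (suc n + toℕ i ∸ toℕ j)          ≡⟨ sym (ℕ.+-∸-assoc 1 j≤n+i) ⟩
    suc (suc n + toℕ i) ∸ toℕ j          ≡⟨ cong (_∸ toℕ j) (sym (ℕ.+-suc (suc n) (toℕ i))) ⟩
    suc n + suc (toℕ i) ∸ toℕ j          ≡⟨ sym (gapℕ-> 1+i<j) ⟩
    gapℕ (toℕ j) (suc (toℕ i))           ∎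
    where
    open ≡.≡-Reasoning
    j≤n+i : toℕ j ≤ suc n + toℕ i
    j≤n+i = ℕ.≤-trans (ℕ.<⇒≤ (Fin.toℕ<n j)) (ℕ.m≤m+n (suc n) (toℕ i))
    1+i<j : suc (toℕ i) < toℕ j
    1+i<j = ℕ.≤∧≢⇒< (ℕ.≰⇒> j≰i) λ e → 1+i≢j (Fin.toℕ-injective e)

  gap-prev< : ∀ j i → i ≢ j → gap j (prev i) < gap j i
  gap-prev< j i i≢j = ℕ.≤-reflexive (gap-prev j i i≢j)

module Setting (q n : ℕ) (r : Fin (suc n) → ℕ) (r-bounds : ∀ i → 1 ≤ r i × r i ≤ 2 + q)
               (J : Subset (suc n)) where
  open ≡ using (refl; sym; trans; cong; cong₂; subst; subst₂)
  open Arithmetic q public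
  open Cyclic n public

  h s : Fin (suc n) → ℕ
  h = hOf r J
  s i = r i ∸ h i

  1≤r : ∀ i → 1 ≤ r i
  1≤r i = proj₁ (r-bounds i)

  r≤p : ∀ i → r i ≤ p
  r≤p i = proj₂ (r-bounds i)

  weights : ∀ i → Weights (r i) (h i) (s i)
  weights i with lookup J i
  ... | true  = subst (Weights (r i) (r i)) (sym (ℕ.n∸n≡0 (r i))) inJ
  ... | false = outJ

  ∈⇒h≡r : ∀ {i} → i ∈ J → h i ≡ r i
  ∈⇒h≡r i∈J rewrite Vec.[]=⇒lookup i∈J = refl

  h≡r⇒∈ : ∀ {i} → h i ≡ r i → i ∈ J
  h≡r⇒∈ {i} h≡r with lookup J i in eq
  ... | true  = Vec.lookup⇒[]= i J eq
  ... | false = contradiction (sym h≡r) (ℕ.<⇒≢ (1≤r i) ∘ sym)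

  J-after-¬p : Set
  J-after-¬p = ∀ i → (i ∈ J) ⇔ (r (prev i) ≢ p)

  StepAt : Fin (suc n) → ℕ → ℕ → Set
  StepAt i m k = Step (s i) (h i) m k

  LowCycleAt TwoCycleAt : Fin (suc n) → Set
  LowCycleAt i = StepAt i (lowDeg (r i)) (lowDeg (r (prev i)))
  TwoCycleAt i = StepAt i 2 2

  lowCycle-after-p : ∀ {i} → LowCycleAt i → r (prev i) ≡ p → h i ≡ 0 × r i ≡ 1
  lowCycle-after-p {i} lc e = lowStep-from-0 (weights i) (1≤r i) (subst (StepAt i _) (lowDeg-≡p e) lc)

  lowCycle-after-¬p : ∀ {i} → LowCycleAt i → r (prev i) ≢ p → h i ≡ r i × (r i ≡ p ⊎ r i ≡ p ∸ 1)
  lowCycle-after-¬p {i} lc e = lowStep-from-1 (weights i) (subst (StepAt i _) (lowDeg-≢p e) lc)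

  allLowCycles⇒InP : (∀ i → LowCycleAt i) → InP p r
  allLowCycles⇒InP lc = values , after-p , after-¬p
    where
    values : ∀ i → (r i ≡ 1 ⊎ r i ≡ p ∸ 1) ⊎ r i ≡ p
    values i with r (prev i) ≟ p
    ... | yes e = inj₁ (inj₁ (proj₂ (lowCycle-after-p (lc i) e)))
    ... | no e with proj₂ (lowCycle-after-¬p (lc i) e)
    ...   | inj₁ r≡p   = inj₂ r≡p
    ...   | inj₂ r≡p-1 = inj₁ (inj₂ r≡p-1)
    after-p : ∀ i → r i ≡ p → r (next i) ≡ 1
    after-p i e = proj₂ (lowCycle-after-p (lc (next i)) (trans (cong r (prev-next i)) e))
    after-¬p : ∀ i → (r i ≡ 1 ⊎ r i ≡ p ∸ 1) → (r (next i) ≡ p ∸ 1 ⊎ r (next i) ≡ p)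
    after-¬p i small = swap (proj₂ (lowCycle-after-¬p (lc (next i)) r≢p))
      where
      r≢p : r (prev (next i)) ≢ p
      r≢p = small≢p small ∘ trans (cong r (sym (prev-next i)))

  allLowCycles⇒J : (∀ i → LowCycleAt i) → J-after-¬p
  allLowCycles⇒J lc i = mk⇔ to from
    where
    to : i ∈ J → r (prev i) ≢ p
    to i∈J e = ℕ.<⇒≢ (1≤r i) (sym (trans (sym (∈⇒h≡r i∈J)) (proj₁ (lowCycle-after-p (lc i) e))))
    from : r (prev i) ≢ p → i ∈ J
    from e = h≡r⇒∈ (proj₁ (lowCycle-after-¬p (lc i) e))

  allTwoCycles⇒ : (∀ i → TwoCycleAt i) → p ≡ 2 × (∀ i → r i ≡ 2) × (∀ i → i ∈ J)
  allTwoCycles⇒ tc = proj₁ (two zero) , (proj₁ ∘ proj₂ ∘ two) , (h≡r⇒∈ ∘ proj₂ ∘ proj₂ ∘ two)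
    where
    two : ∀ i → p ≡ 2 × r i ≡ 2 × h i ≡ r i
    two i = twoStep-shape (weights i) (r≤p i) (tc i)

  InP⇒¬all≡2 : InP p r → p ≡ 2 → ¬ (∀ i → r i ≡ 2)
  InP⇒¬all≡2 (_ , after-p , _) p≡2 all≡2 with
    trans (sym (all≡2 (next zero))) (after-p zero (trans (all≡2 zero) (sym p≡2)))
  ... | ()

  InP-large-on-J : InP p r → J-after-¬p → ∀ {i} → i ∈ J → r i ≡ p ∸ 1 ⊎ r i ≡ p
  InP-large-on-J (values , _ , after-¬p) J⇔ {i} i∈J with values (prev i)
  ... | inj₂ e = contradiction e (Equivalence.to (J⇔ i) i∈J)
  ... | inj₁ small = subst (λ j → r j ≡ p ∸ 1 ⊎ r j ≡ p) (next-prev i) (after-¬p (prev i) small)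

  lowDeg+h≡p : InP p r → J-after-¬p → ∀ {i} → i ∈ J → lowDeg (r i) + h i ≡ p
  lowDeg+h≡p inp J⇔ {i} i∈J =
    trans (cong (lowDeg (r i) +_) (∈⇒h≡r i∈J)) (lowDeg+large≡p (InP-large-on-J inp J⇔ i∈J))

  module Ranking (Cut : Fin (suc n) → ℕ → Set) (jC j2 : Fin (suc n))
                 (jC-cut : LowCycleAt jC → Cut jC (lowDeg (r jC)))
                 (j2-cut : TwoCycleAt j2 → Cut j2 2) where

    W : ℕ
    W = 2 + n

    lowRank : Fin (suc n) → ℕ → ℕ
    lowRank i m = if does (m ≟ lowDeg (r i)) then suc (gap jC i) else 0

    -- A step into degree m ≥ 3 starts in lower degree, one into degree 2 in degree ≤ 2, and one into
    -- degree m ≤ 1 in degree ≤ 1 with m = lowDeg r_i. Steps staying at degree 2, or between degrees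
    -- lowDeg r_i, walk back towards j2, resp. jC, where a cycle of that kind is cut.
    rank : Fin (suc n) → ℕ → ℕ
    rank i zero = lowRank i 0
    rank i (suc zero) = lowRank i 1
    rank i (suc (suc m)) = W * suc m + gap j2 i

    lowRank-on-cycle : ∀ {i m} → m ≡ lowDeg (r i) → lowRank i m ≡ suc (gap jC i)
    lowRank-on-cycle {i} {m} e = cong (λ b → if b then suc (gap jC i) else 0) (dec-true (m ≟ lowDeg (r i)) e)

    lowRank-off-cycle : ∀ {i m} → m ≢ lowDeg (r i) → lowRank i m ≡ 0
    lowRank-off-cycle {i} {m} ne = cong (λ b → if b then suc (gap jC i) else 0) (dec-false (m ≟ lowDeg (r i)) ne)

    lowRank<W : ∀ i m → lowRank i m < W
    lowRank<W i m with does (m ≟ lowDeg (r i))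
    ... | true  = s≤s (s≤s (gap≤n jC i))
    ... | false = s≤s z≤n

    gap<W : ∀ j i → gap j i < W
    gap<W j i = s≤s (ℕ.≤-trans (gap≤n j i) (ℕ.n≤1+n n))

    low-src : ∀ {i m k} → m ≤ 1 → StepAt i m k → k ≤ 1
    low-src {i} {m} {k} m≤1 st = ℕ.≤-pred (ℕ.*-cancelˡ-< 2 k 2 (s≤s (begin
      2 * k  ≤⟨ step-src-bound {k = k} (weights i) (r≤p i) st ⟩
      2 + m  ≤⟨ ℕ.+-monoʳ-≤ 2 m≤1 ⟩
      3      ∎)))
      where open ℕ.≤-Reasoning

    rank-low : ∀ i {k} → k ≤ 1 → rank i k ≡ lowRank i k
    rank-low i z≤n = refl
    rank-low i (s≤s z≤n) = refl

    rank-step-low : ∀ {i m} k → ¬ Cut i m → m ≤ 1 → StepAt i m k → rank (prev i) k < lowRank i m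
    rank-step-low {i} {m} k ¬cut m≤1 st = begin-strict
      rank (prev i) k     ≡⟨ rank-low (prev i) (low-src {i} {m} {k} m≤1 st) ⟩
      lowRank (prev i) k  <⟨ below ⟩
      suc (gap jC i)      ≡⟨ sym (lowRank-on-cycle m-low) ⟩
      lowRank i m         ∎
      where
      open ℕ.≤-Reasoning
      m-low : m ≡ lowDeg (r i)
      m-low = step-lowDeg (weights i) (1≤r i) m≤1 (low-src {i} {m} {k} m≤1 st) st
      below : lowRank (prev i) k < suc (gap jC i)
      below with k ≟ lowDeg (r (prev i))
      ... | no k≢low = ℕ.≤-trans (s≤s (ℕ.≤-reflexive (lowRank-off-cycle k≢low))) (s≤s z≤n)
      ... | yes k-low = s≤s (ℕ.≤-trans (ℕ.≤-reflexive (lowRank-on-cycle k-low)) (gap-prev< jC i i≢jC))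
        where
        i≢jC : i ≢ jC
        i≢jC refl = ¬cut (subst (Cut i) (sym m-low) (jC-cut (subst₂ (StepAt i) m-low k-low st)))

    two-src : ∀ {i m k} → StepAt i (2 + m) (2 + k) → 2 * k ≤ m
    two-src {i} {m} {k} st = ℕ.+-cancelˡ-≤ 4 (2 * k) m (begin
      4 + 2 * k          ≡⟨ cong (2 +_) (sym (ℕ.*-suc 2 k)) ⟩
      2 + 2 * suc k      ≡⟨ sym (ℕ.*-suc 2 (suc k)) ⟩
      2 * suc (suc k)    ≤⟨ step-src-bound {k = 2 + k} (weights i) (r≤p i) st ⟩
      4 + m              ∎)
      where open ℕ.≤-Reasoning

    W≤rank : ∀ i m → W ≤ rank i (2 + m)
    W≤rank i m = ℕ.≤-trans (ℕ.m≤m*n W (suc m)) (ℕ.m≤m+n (W * suc m) (gap j2 i))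

    rank-step : ∀ {i m} k → ¬ Cut i m → StepAt i m k → rank (prev i) k < rank i m
    rank-step {i} {zero} k ¬cut st = rank-step-low k ¬cut z≤n st
    rank-step {i} {suc zero} k ¬cut st = rank-step-low k ¬cut (s≤s z≤n) st
    rank-step {i} {suc (suc m)} zero _ _ = ℕ.<-≤-trans (lowRank<W (prev i) 0) (W≤rank i m)
    rank-step {i} {suc (suc m)} (suc zero) _ _ = ℕ.<-≤-trans (lowRank<W (prev i) 1) (W≤rank i m)
    rank-step {i} {2} 2 ¬cut st = ℕ.+-monoʳ-< (W * 1) (gap-prev< j2 i i≢j2)
      where
      i≢j2 : i ≢ j2
      i≢j2 refl = ¬cut (j2-cut st)
    rank-step {i} {2} (suc (suc (suc k))) _ st = contradiction (two-src {i} {0} {suc k} st) λ ()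
    rank-step {i} {suc (suc (suc m))} (suc (suc k)) _ st = begin-strict
      W * suc k + gap j2 (prev i)  <⟨ ℕ.+-monoʳ-< (W * suc k) (gap<W j2 (prev i)) ⟩
      W * suc k + W                ≡⟨ ℕ.+-comm (W * suc k) W ⟩
      W + W * suc k                ≡⟨ sym (ℕ.*-suc W (suc k)) ⟩
      W * suc (suc k)              ≤⟨ ℕ.*-monoʳ-≤ W (s≤s (half< (two-src {i} {suc m} {k} st) (s≤s z≤n))) ⟩
      W * suc (suc m)              ≤⟨ ℕ.m≤m+n (W * suc (suc m)) (gap j2 i) ⟩
      rank i (3 + m)               ∎
      where open ℕ.≤-Reasoning

module Construction {c ℓ : Level} (kE : CommutativeRing c ℓ)
                    (q n : ℕ) (r : Fin (suc n) → ℕ) (r-bounds : ∀ i → 1 ≤ r i × r i ≤ 2 + q)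
                    (J : Subset (suc n)) where
  open CommutativeRing kE hiding (zero) renaming (_+_ to _⊕_; _*_ to _·_)
  open Phi kE
  open PowerSeries kE
  open Setting q n r r-bounds J
  open Grid p
  open import Relation.Binary.Reasoning.Setoid setoid
  open import Algebra.Properties.AbelianGroup +-abelianGroup using (xyx⁻¹≈y)
  open import Algebra.Properties.CommutativeSemigroup +-commutativeSemigroup using (xy∙z≈xz∙y)

  tw-cancel : ∀ {a a⁻¹} → a · a⁻¹ ≈ 1# → ∀ (i : Fin (suc n)) z → tw a i · (tw a⁻¹ i · z) ≈ z
  tw-cancel {a} {a⁻¹} a·a⁻¹≈1 i z = begin
    tw a i · (tw a⁻¹ i · z)  ≈⟨ *-assoc _ _ z ⟨
    (tw a i · tw a⁻¹ i) · z  ≈⟨ *-congʳ (tw-inverse i) ⟩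
    1# · z                   ≈⟨ *-identityˡ z ⟩
    z                        ∎
    where
    tw-inverse : ∀ i → tw a i · tw a⁻¹ i ≈ 1#
    tw-inverse zero = a·a⁻¹≈1
    tw-inverse (suc _) = *-identityˡ 1#

  affine-root : ∀ {a b d} β Y → (a ⊕ - b) · d ≈ 1# →
                let Z = d · (β · b ⊕ Y) in ((β ⊕ Z) · b ⊕ Y) ⊕ - (a · Z) ≈ 0#
  affine-root {a} {b} {d} β Y inv = begin
    ((β ⊕ Z) · b ⊕ Y) ⊕ - (a · Z)  ≈⟨ +-cong (trans (+-congʳ (distribʳ b β Z)) (xy∙z≈xz∙y _ _ Y))
                                             (-‿cong a·Z) ⟩
    (W ⊕ Z · b) ⊕ - (W ⊕ Z · b)    ≈⟨ -‿inverseʳ _ ⟩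
    0#                             ∎
    where
    W Z : Carrier
    W = β · b ⊕ Y
    Z = d · W
    a·Z : a · Z ≈ W ⊕ Z · b
    a·Z = begin
      a · Z                        ≈⟨ *-congʳ a-b+b≈a ⟨
      ((a ⊕ - b) ⊕ b) · Z          ≈⟨ distribʳ Z _ b ⟩
      (a ⊕ - b) · (d · W) ⊕ b · Z  ≈⟨ +-cong [a-b]·Z≈W (*-comm b Z) ⟩
      W ⊕ Z · b                    ∎
      where
      a-b+b≈a : (a ⊕ - b) ⊕ b ≈ a
      a-b+b≈a = trans (+-assoc a (- b) b) (trans (+-congˡ (-‿inverseˡ b)) (+-identityʳ a))
      [a-b]·Z≈W : (a ⊕ - b) · (d · W) ≈ W
      [a-b]·Z≈W = trans (sym (*-assoc _ d W)) (trans (*-congʳ inv) (*-identityˡ W))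

  module ChangeOfBasis (a b a⁻¹ : Carrier) (a·a⁻¹≈1 : a · a⁻¹ ≈ 1#) (y : Fin (suc n) → PS)
                  (Cut : Fin (suc n) → ℕ → Set) (cut? : ∀ i m → Dec (Cut i m))
                  (rank : Fin (suc n) → ℕ → ℕ)
                  (rank-step : ∀ {i m} k → ¬ Cut i m → StepAt i m k → rank (prev i) k < rank i m) where

    -- Λ Z i m is the coefficient of u^m in Λ_i, with the free value Z at the cut points.
    Λ-approx : Carrier → ℕ → Fin (suc n) → ℕ → Carrier
    Λ-approx Z zero i m = 0#
    Λ-approx Z (suc t) i m with cut? i m | grid? (s i) (m + h i)
    ... | yes _ | _           = Z
    ... | no _  | yes (k , _) = tw a⁻¹ i · (y i (m + h i) ⊕ Λ-approx Z t (prev i) k · tw b i)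
    ... | no _  | no _        = tw a⁻¹ i · y i (m + h i)

    Λ-approx-stable : ∀ Z {t t′} i m → rank i m < t → rank i m < t′ → Λ-approx Z t i m ≈ Λ-approx Z t′ i m
    Λ-approx-stable Z i m (s≤s r≤t) (s≤s r≤t′) with cut? i m | grid? (s i) (m + h i)
    ... | yes _   | _            = refl
    ... | no _    | no _         = refl
    ... | no ¬cut | yes (k , st) = *-congˡ (+-congˡ (*-congʳ
      (Λ-approx-stable Z (prev i) k (ℕ.<-≤-trans descent r≤t) (ℕ.<-≤-trans descent r≤t′))))
      where
      descent : rank (prev i) k < rank i m
      descent = rank-step k ¬cut st

    Λ : Carrier → Fin (suc n) → PS
    Λ Z i m = Λ-approx Z (suc (rank i m)) i m

    Λ-cut : ∀ Z {i m} → Cut i m → Λ Z i m ≈ Z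
    Λ-cut Z {i} {m} cut with cut? i m | grid? (s i) (m + h i)
    ... | yes _   | _ = refl
    ... | no ¬cut | _ = ⊥-elim (¬cut cut)

    twistedFrob : Carrier → Fin (suc n) → PS
    twistedFrob Z i = frob p (Λ Z (prev i)) *ₚ mono (tw b i) (s i)

    Λ-recurrence : ∀ Z {i m} → ¬ Cut i m → tw a i · Λ Z i m ≈ twistedFrob Z i (m + h i) ⊕ y i (m + h i)
    Λ-recurrence Z {i} {m} ¬cut with cut? i m | grid? (s i) (m + h i)
    ... | yes cut | _ = ⊥-elim (¬cut cut)
    ... | no _ | yes (k , st) = begin
      tw a i · (tw a⁻¹ i · (y i (m + h i) ⊕ Λ-approx Z (rank i m) (prev i) k · tw b i))
        ≈⟨ tw-cancel a·a⁻¹≈1 i _ ⟩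
      y i (m + h i) ⊕ Λ-approx Z (rank i m) (prev i) k · tw b i
        ≈⟨ +-congˡ (*-congʳ (Λ-approx-stable Z (prev i) k (rank-step k ¬cut st) (ℕ.n<1+n _))) ⟩
      y i (m + h i) ⊕ Λ Z (prev i) k · tw b i
        ≈⟨ +-comm _ _ ⟩
      Λ Z (prev i) k · tw b i ⊕ y i (m + h i)
        ≈⟨ +-congʳ (frob-*ₚ-mono p (Λ Z (prev i)) (tw b i) (s i) st) ⟨
      twistedFrob Z i (m + h i) ⊕ y i (m + h i) ∎
    ... | no _ | no none = begin
      tw a i · (tw a⁻¹ i · y i (m + h i))        ≈⟨ tw-cancel a·a⁻¹≈1 i _ ⟩
      y i (m + h i)                              ≈⟨ +-identityˡ _ ⟨
      0# ⊕ y i (m + h i)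
        ≈⟨ +-congʳ (frob-*ₚ-mono-off p (Λ Z (prev i)) (tw b i) (s i) none) ⟨
      twistedFrob Z i (m + h i) ⊕ y i (m + h i)  ∎

    x : Carrier → Fin (suc n) → PS
    x Z i = (twistedFrob Z i +ₚ y i) +ₚ (-ₚ (mono (tw a i) (h i) *ₚ Λ Z i))

    x-vanishes : ∀ Z {i} m → ¬ Cut i m → x Z i (m + h i) ≈ 0#
    x-vanishes Z {i} m ¬cut = begin
      (twistedFrob Z i (m + h i) ⊕ y i (m + h i)) ⊕ - (mono (tw a i) (h i) *ₚ Λ Z i) (m + h i)
        ≈⟨ +-congˡ (-‿cong (trans (mono-*ₚ (Λ Z i) (tw a i) (h i) m) (Λ-recurrence Z ¬cut))) ⟩
      (twistedFrob Z i (m + h i) ⊕ y i (m + h i)) ⊕ - (twistedFrob Z i (m + h i) ⊕ y i (m + h i))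
        ≈⟨ -‿inverseʳ _ ⟩
      0# ∎

    normalForm : ∀ Z (Good : Fin (suc n) → PS → Set ℓ) → (∀ i → Good i (x Z i)) →
                 HasNormalForm p r h a b y Good
    normalForm Z Good good =
      (λ _ → oneₚ , zeroₚ) , (λ i → Λ Z i , oneₚ) , x Z
      , (λ i → unitriangular-isBasis (Λ Z i)) , φe , φf , good
      where
      φe : ∀ i → phiExt p r h a b y i (oneₚ , zeroₚ) ≈ₑ (mono (tw b i) (s i) ·ₑ (oneₚ , zeroₚ))
      φe i = (λ k → trans (+-cong (frob-oneₚ-*ₚ p B k) (frob-zeroₚ-*ₚ p (y i) k))
                          (trans (+-identityʳ _) (sym (*ₚ-identityʳ B k))))
           , (λ k → trans (frob-zeroₚ-*ₚ p (mono (tw a i) (h i)) k) (sym (*ₚ-zeroʳ B k)))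
        where
        B : PS
        B = mono (tw b i) (s i)
      φf : ∀ i → phiExt p r h a b y i (Λ Z (prev i) , oneₚ)
                   ≈ₑ ((mono (tw a i) (h i) ·ₑ (Λ Z i , oneₚ)) +ₑ (x Z i ·ₑ (oneₚ , zeroₚ)))
      φf i = first , (λ k → trans (frob-oneₚ-*ₚ p A′ k)
                                  (sym (trans (+-cong (*ₚ-identityʳ A′ k) (*ₚ-zeroʳ (x Z i) k)) (+-identityʳ _))))
        where
        A′ A : PS
        A′ = mono (tw a i) (h i)
        A = A′ *ₚ Λ Z i
        first : ∀ k → twistedFrob Z i k ⊕ (frob p oneₚ *ₚ y i) k ≈ A k ⊕ (x Z i *ₚ oneₚ) k
        first k = begin
          twistedFrob Z i k ⊕ (frob p oneₚ *ₚ y i) k   ≈⟨ +-congˡ (frob-oneₚ-*ₚ p (y i) k) ⟩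
          twistedFrob Z i k ⊕ y i k                    ≈⟨ xyx⁻¹≈y (A k) _ ⟨
          (A k ⊕ (twistedFrob Z i k ⊕ y i k)) ⊕ - A k  ≈⟨ +-assoc _ _ _ ⟩
          A k ⊕ x Z i k                                ≈⟨ +-congˡ (*ₚ-identityʳ (x Z i) k) ⟨
          A k ⊕ (x Z i *ₚ oneₚ) k                      ∎

    polynomialNormalForm : ∀ Z → (∀ i m → x Z i (m + h i) ≈ 0#) →
                           HasNormalForm p r h a b y (λ i ξ → PolyDeg< (h i) ξ)
    polynomialNormalForm Z vanish = normalForm Z (λ i ξ → PolyDeg< (h i) ξ) λ i → PolyDeg<-intro (vanish i)

    -- Cutting at index 0 makes all twists (a)_i, (b)_i along the rest of the cycle equal to 1.
    module Cycle (cyc : Fin (suc n) → ℕ) (cyc-step : ∀ i → StepAt i (cyc i) (cyc (prev i)))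
                 (cut-at : Cut zero (cyc zero))
                 (cut-only : ∀ {i m} → Cut i m → i ≡ zero × m ≡ cyc zero) where

      ¬cut-suc : ∀ j {m} → ¬ Cut (suc j) m
      ¬cut-suc j cut with () ← proj₁ (cut-only cut)

      Λ-along-cycle : ∀ Z j → Λ Z (suc j) (cyc (suc j))
                              ≈ Λ Z (prev (suc j)) (cyc (prev (suc j))) ⊕ y (suc j) (cyc (suc j) + h (suc j))
      Λ-along-cycle Z j = begin
        Λ Z i (cyc i)                                   ≈⟨ *-identityˡ _ ⟨
        1# · Λ Z i (cyc i)                              ≈⟨ Λ-recurrence Z (¬cut-suc j) ⟩
        twistedFrob Z i (cyc i + h i) ⊕ y i (cyc i + h i)
          ≈⟨ +-congʳ (frob-*ₚ-mono p (Λ Z (prev i)) 1# (s i) (cyc-step i)) ⟩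
        Λ Z (prev i) (cyc (prev i)) · 1# ⊕ y i (cyc i + h i)
          ≈⟨ +-congʳ (*-identityʳ _) ⟩
        Λ Z (prev i) (cyc (prev i)) ⊕ y i (cyc i + h i)  ∎
        where
        i : Fin (suc n)
        i = suc j

      Λ-shift : ∀ Z {t} i → rank i (cyc i) < t → Λ Z i (cyc i) ≈ Λ 0# i (cyc i) ⊕ Z
      Λ-shift Z zero _ = begin
        Λ Z zero (cyc zero)        ≈⟨ Λ-cut Z cut-at ⟩
        Z                          ≈⟨ +-identityˡ Z ⟨
        0# ⊕ Z                     ≈⟨ +-congʳ (Λ-cut 0# cut-at) ⟨
        Λ 0# zero (cyc zero) ⊕ Z   ∎
      Λ-shift Z (suc j) (s≤s r≤t) = begin
        Λ Z (suc j) (cyc (suc j))        ≈⟨ Λ-along-cycle Z j ⟩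
        Λ Z i′ (cyc i′) ⊕ Y              ≈⟨ +-congʳ (Λ-shift Z i′ (ℕ.<-≤-trans descent r≤t)) ⟩
        (Λ 0# i′ (cyc i′) ⊕ Z) ⊕ Y       ≈⟨ xy∙z≈xz∙y _ Z Y ⟩
        (Λ 0# i′ (cyc i′) ⊕ Y) ⊕ Z       ≈⟨ +-congʳ (Λ-along-cycle 0# j) ⟨
        Λ 0# (suc j) (cyc (suc j)) ⊕ Z   ∎
        where
        i′ : Fin (suc n)
        i′ = prev (suc j)
        Y : Carrier
        Y = y (suc j) (cyc (suc j) + h (suc j))
        descent : rank i′ (cyc i′) < rank (suc j) (cyc (suc j))
        descent = rank-step (cyc i′) (¬cut-suc j) (cyc-step (suc j))

      β Y₀ : Carrier
      β = Λ 0# (prev zero) (cyc (prev zero))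
      Y₀ = y zero (cyc zero + h zero)

      x-at-cut : ∀ Z → x Z zero (cyc zero + h zero) ≈ ((β ⊕ Z) · b ⊕ Y₀) ⊕ - (a · Z)
      x-at-cut Z = +-cong (+-congʳ incoming)
                          (-‿cong (trans (mono-*ₚ (Λ Z zero) a (h zero) (cyc zero)) (*-congˡ (Λ-cut Z cut-at))))
        where
        incoming : twistedFrob Z zero (cyc zero + h zero) ≈ (β ⊕ Z) · b
        incoming = trans (frob-*ₚ-mono p (Λ Z (prev zero)) b (s zero) (cyc-step zero))
                         (*-congʳ (Λ-shift Z (prev zero) (ℕ.n<1+n _)))

      x-solved : ∀ {d} → (a ⊕ - b) · d ≈ 1# → ∀ i m → x (d · (β · b ⊕ Y₀)) i (m + h i) ≈ 0#
      x-solved {d} inv i m with cut? i m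
      ... | no ¬cut = x-vanishes _ m ¬cut
      ... | yes cut with cut-only cut
      ...   | ≡.refl , ≡.refl = trans (x-at-cut _) (affine-root β Y₀ inv)

module NormalForms {c ℓ : Level} (kE : CommutativeRing c ℓ) (kE-field : IsField kE)
             (q n : ℕ) (r : Fin (suc n) → ℕ) (r-bounds : ∀ i → 1 ≤ r i × r i ≤ 2 + q)
             (J : Subset (suc n)) where
  open CommutativeRing kE hiding (zero) renaming (_+_ to _⊕_; _*_ to _·_)
  open Phi kE
  open PowerSeries kE
  open Setting q n r r-bounds J
  open Construction kE q n r r-bounds J
  open import Algebra.Properties.AbelianGroup +-abelianGroup using (x∙y⁻¹≈ε⇒x≈y)

  PointCut : Fin (suc n) → ℕ → Fin (suc n) → ℕ → Set
  PointCut i₀ m₀ i m = i ≡ i₀ × m ≡ m₀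

  pointCut? : ∀ i₀ m₀ i m → Dec (PointCut i₀ m₀ i m)
  pointCut? i₀ m₀ i m = (i Fin.≟ i₀) ×-dec (m ≟ m₀)

  lowCycle? : ∀ i → Dec (LowCycleAt i)
  lowCycle? i = _ ≟ _

  twoCycle? : ∀ i → Dec (TwoCycleAt i)
  twoCycle? i = _ ≟ _

  noLowCycle : ¬ (∀ i → LowCycleAt i) → ∃ λ j → ¬ LowCycleAt j
  noLowCycle = Fin.¬∀⟶∃¬ (suc n) LowCycleAt lowCycle?

  noTwoCycle : ¬ (∀ i → TwoCycleAt i) → ∃ λ j → ¬ TwoCycleAt j
  noTwoCycle = Fin.¬∀⟶∃¬ (suc n) TwoCycleAt twoCycle?

  InP⇒noTwoCycle : InP p r → ∃ λ j → ¬ TwoCycleAt j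
  InP⇒noTwoCycle inp = noTwoCycle λ two →
    let p≡2 , r≡2 , _ = allTwoCycles⇒ two in InP⇒¬all≡2 inp p≡2 r≡2

  module Extension (a b : Carrier) (a≉0 : ¬ a ≈ 0#) (y : Fin (suc n) → PS) where

    CaseI CaseII : Set ℓ
    CaseI = InP p r × J-after-¬p × a ≈ b
    CaseII = p ≡ 2 × (∀ i → r i ≡ 2) × (∀ i → i ∈ J) × a ≈ b

    a-b-invertible : ¬ a ≈ b → ∃ λ d → (a ⊕ - b) · d ≈ 1#
    a-b-invertible a≉b = proj₂ kE-field (a ⊕ - b) (a≉b ∘ x∙y⁻¹≈ε⇒x≈y a b)

    module CutConstruction (Cut : Fin (suc n) → ℕ → Set) (cut? : ∀ i m → Dec (Cut i m))
                           (jC j2 : Fin (suc n)) (jC-cut : LowCycleAt jC → Cut jC (lowDeg (r jC)))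
                           (j2-cut : TwoCycleAt j2 → Cut j2 2) =
      ChangeOfBasis a b (proj₁ (proj₂ kE-field a a≉0)) (proj₂ (proj₂ kE-field a a≉0)) y Cut cut?
                    (Ranking.rank Cut jC j2 jC-cut j2-cut) (Ranking.rank-step Cut jC j2 jC-cut j2-cut)

    nonExceptional : ¬ (CaseI ⊎ CaseII) → HasNormalForm p r h a b y (λ i ξ → PolyDeg< (h i) ξ)
    nonExceptional ¬exc with Fin.all? lowCycle? | Fin.all? twoCycle?
    ... | yes low | _ = polynomialNormalForm _ (x-solved (proj₂ solvable))
      where
      inp : InP p r
      inp = allLowCycles⇒InP low
      open CutConstruction (PointCut zero (lowDeg (r zero))) (pointCut? _ _)
                           zero (proj₁ (InP⇒noTwoCycle inp))
                           (λ _ → ≡.refl , ≡.refl) (⊥-elim ∘ proj₂ (InP⇒noTwoCycle inp))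
      open Cycle (λ i → lowDeg (r i)) low (≡.refl , ≡.refl) id
      solvable : ∃ λ d → (a ⊕ - b) · d ≈ 1#
      solvable = a-b-invertible λ a≈b → ¬exc (inj₁ (inp , allLowCycles⇒J low , a≈b))
    ... | no ¬low | yes two = polynomialNormalForm _ (x-solved (proj₂ solvable))
      where
      open CutConstruction (PointCut zero 2) (pointCut? _ _)
                           (proj₁ (noLowCycle ¬low)) zero
                           (⊥-elim ∘ proj₂ (noLowCycle ¬low)) (λ _ → ≡.refl , ≡.refl)
      open Cycle (λ _ → 2) two (≡.refl , ≡.refl) id
      solvable : ∃ λ d → (a ⊕ - b) · d ≈ 1#
      solvable = a-b-invertible λ a≈b →
        let p≡2 , r≡2 , all∈J = allTwoCycles⇒ two in ¬exc (inj₂ (p≡2 , r≡2 , all∈J , a≈b))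
    ... | no ¬low | no ¬two = polynomialNormalForm 0# λ i m → x-vanishes 0# m λ ()
      where
      open CutConstruction (λ _ _ → ⊥) (λ _ _ → no λ ())
                           (proj₁ (noLowCycle ¬low)) (proj₁ (noTwoCycle ¬two))
                           (⊥-elim ∘ proj₂ (noLowCycle ¬low)) (⊥-elim ∘ proj₂ (noTwoCycle ¬two))

    ExceptionalShape : Fin (suc n) → Fin (suc n) → PS → Set ℓ
    ExceptionalShape i₀ i ξ =
      (i ≢ i₀ → PolyDeg< (h i) ξ) × (i ≡ i₀ → (CaseI → PolyDeg<Plus (h i) p ξ) × (CaseII → PolyDeg<Plus (h i) 4 ξ))

    exceptional : CaseI ⊎ CaseII → ∀ i₀ → i₀ ∈ J → HasNormalForm p r h a b y (ExceptionalShape i₀)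
    exceptional (inj₁ (inp , J⇔ , _)) i₀ i₀∈J = normalForm 0# (ExceptionalShape i₀) shape
      where
      open CutConstruction (PointCut i₀ (lowDeg (r i₀))) (pointCut? _ _)
                           i₀ (proj₁ (InP⇒noTwoCycle inp))
                           (λ _ → ≡.refl , ≡.refl) (⊥-elim ∘ proj₂ (InP⇒noTwoCycle inp))
      shape : ∀ i → ExceptionalShape i₀ i (x 0# i)
      shape i = (λ i≢i₀ → PolyDeg<-intro λ m → x-vanishes 0# m (i≢i₀ ∘ proj₁))
              , λ { ≡.refl → (λ _ → PolyDeg<Plus-intro (lowDeg (r i)) (lowDeg+h≡p inp J⇔ i₀∈J)
                                      λ m m≢ → x-vanishes 0# m (m≢ ∘ proj₂))
                           , λ (p≡2 , r≡2 , _) → ⊥-elim (InP⇒¬all≡2 inp p≡2 r≡2) }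
    exceptional (inj₂ (p≡2 , r≡2 , _)) i₀ i₀∈J = normalForm 0# (ExceptionalShape i₀) shape
      where
      someNonLow : ∃ λ j → ¬ LowCycleAt j
      someNonLow = noLowCycle λ low → InP⇒¬all≡2 (allLowCycles⇒InP low) p≡2 r≡2
      open CutConstruction (PointCut i₀ 2) (pointCut? _ _)
                           (proj₁ someNonLow) i₀
                           (⊥-elim ∘ proj₂ someNonLow) (λ _ → ≡.refl , ≡.refl)
      shape : ∀ i → ExceptionalShape i₀ i (x 0# i)
      shape i = (λ i≢i₀ → PolyDeg<-intro λ m → x-vanishes 0# m (i≢i₀ ∘ proj₁))
              , λ { ≡.refl → (λ (inp , _) → ⊥-elim (InP⇒¬all≡2 inp p≡2 r≡2))
                           , λ _ → PolyDeg<Plus-intro 2 (≡.cong (2 +_) (≡.trans (∈⇒h≡r i₀∈J) (r≡2 i)))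
                                     λ m m≢ → x-vanishes 0# m (m≢ ∘ proj₂) }

proposition7p4 :
    ∀ {c ℓ : Level} (p f : ℕ) → Prime p → 1 ≤ f →
    -- k_E : a finite field of characteristic p containing 𝔽_{p^f}
    (kE : CommutativeRing c ℓ) → IsField kE → HasCharDividing kE p →
    (∃ λ n → 1 ≤ n × HasCardinality kE (p ^ (f * n))) →
    let open CommutativeRing kE
        open Phi kE
    in
    (r : Fin f → ℕ) → (∀ i → 1 ≤ r i × r i ≤ p) →
    (J : Subset f) →
    (a b : Carrier) → ¬ (a ≈ 0#) → ¬ (b ≈ 0#) →
    -- the extension: φ(e_{i-1}) = (b)_i u^{r_i-h_i} e_i, φ(f_{i-1}) = (a)_i u^{h_i} f_i + y_i e_i
    (y : Fin f → PS) →
    let h = hOf r J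
        CaseI = InP p r × (∀ i → (i ∈ J) ⇔ (r (prev i) ≢ p)) × a ≈ b
        CaseII = p ≡ 2 × (∀ i → r i ≡ 2) × (∀ i → i ∈ J) × a ≈ b
    in
    (¬ (CaseI ⊎ CaseII) →
       HasNormalForm p r h a b y (λ i x → PolyDeg< (h i) x))
    × ((CaseI ⊎ CaseII) → (i₀ : Fin f) → i₀ ∈ J →
       HasNormalForm p r h a b y
         (λ i x → (i ≢ i₀ → PolyDeg< (h i) x)
                  × (i ≡ i₀ → (CaseI → PolyDeg<Plus (h i) p x)
                              × (CaseII → PolyDeg<Plus (h i) 4 x))))
proposition7p4 0 _ 0-prime = ⊥-elim (¬prime[0] 0-prime)
proposition7p4 1 _ 1-prime = ⊥-elim (¬prime[1] 1-prime)
proposition7p4 (suc (suc _)) zero _ ()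
proposition7p4 (suc (suc q)) (suc n) _ _ kE kE-field _ _ r r-bounds J a b a≉0 _ y =
  nonExceptional , exceptional
  where open NormalForms.Extension kE kE-field q n r r-bounds J a b a≉0 y
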